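{- Let $\varphi$ be a $\mathrm{D}$-formula and $\mathcal{G}=(\mathbb{P}_\mathbb{S},\mathcal{L})$ a weak compass $\varphi$-structure over a finite linear order $\mathbb{S}$ identified with $\{0,\dots,N\}$. Then $\mathcal{G}$ is a homogeneous fulfilling compass $\varphi$-structure if and only if for every point $(x,y)\in\mathbb{P}_\mathbb{S}$: (i) if $x<y$ then $\mathcal{L}(x,y-1)\,\mathcal{L}(x+1,y)\Rightarrow\mathcal{L}(x,y)$, and (ii) if $x=y$ then $\mathcal{R}eq_D(\mathcal{L}(x,y))=\emptyset$.
   Context: Formulas: $\varphi ::= p\mid\neg\varphi\mid\varphi\vee\varphi\mid\langle D\rangle\varphi$, $p\in\mathcal{AP}$; $[D]\psi:=\neg\langle D\rangle\neg\psi$. $\mathrm{CL}(\varphi)$: subformulas and their negations, identifying $\neg\neg\psi$ with $\psi$ and $\neg\langle D\rangle\psi$ with $[D]\neg\psi$. A $\varphi$-atom is $A\subseteq\mathrm{CL}(\varphi)$ with $\psi\in A$ iff $\neg\psi\notin A$, and $\psi_1\vee\psi_2\in A$ iff $\psi_1\in A$ or $\psi_2\in A$. $\mathcal{R}eq_D(A)=\{\psi:\langle D\rangle\psi\in A\}$, $\mathrm{REQ}_\varphi=\{\psi:\langle D\rangle\psi\in\mathrm{CL}(\varphi)\}$, $\mathcal{O}bs_D(A)=A\cap\mathrm{REQ}_\varphi$. $A\,D_\varphi\,A'$ iff for every $[D]\psi\in A$, $\psi\in A'$ and $[D]\psi\in A'$. $A_1A_2\Rightarrow A_3$ iff $A_3\cap\mathcal{AP}=A_1\cap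 A_2\cap\mathcal{AP}$ and $\mathcal{R}eq_D(A_3)=\mathcal{R}eq_D(A_1)\cup\mathcal{R}eq_D(A_2)\cup\mathcal{O}bs_D(A_1)\cup\mathcal{O}bs_D(A_2)$. $\mathbb{P}_\mathbb{S}=\{(x,y):x\le y\}$; $(x',y')\sqsubset(x,y)$ iff $x\le x'$, $y'\le y$, $(x',y')\ne(x,y)$. A weak compass $\varphi$-structure is $(\mathbb{P}_\mathbb{S},\mathcal{L})$ with $\mathcal{L}$ an arbitrary map from points to $\varphi$-atoms; it is a compass $\varphi$-structure if moreover $(x',y')\sqsubset(x,y)$ implies $\mathcal{L}(x,y)\,D_\varphi\,\mathcal{L}(x',y')$; fulfilling if for each point $(x,y)$ and $\psi\in\mathcal{R}eq_D(\mathcal{L}(x,y))$ there is $(x',y')\sqsubset(x,y)$ with $\psi\in\mathcal{L}(x',y')$; homogeneous if for each point $(x,y)$ and $p\in\mathcal{AP}$, $p\in\mathcal{L}(x,y)$ iff $p\in\mathcal{L}(x',x')$ for all $x'\in[x,y]$. -}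

module Defs where

open import Data.Nat using (ℕ; _≤_; _<_)
open import Data.Bool using (Bool; true; false)
open import Data.List using (List; []; _∷_; _++_; concatMap)
open import Data.List.Membership.Propositional using (_∈_)
open import Data.Product using (_×_; _,_; Σ-syntax; ∃-syntax)
open import Data.Sum using (_⊎_)
open import Relation.Binary.PropositionalEquality using (_≡_)
open import Relation.Nullary using (¬_)
open import Function.Bundles using (_⇔_)

data Formula : Set where
  atom : ℕ → Formula
  neg  : Formula → Formula
  or   : Formula → Formula → Formula
  dia  : Formula → Formula

-- negation modulo the identification ¬¬ψ = ψ
∼_ : Formula → Formula
∼ neg ψ = ψ
∼ atom p = neg (atom p)
∼ or a b = neg (or a b)
∼ dia a = neg (dia a)

nf : Formula → Formula
nf (atom p) = atom p
nf (neg a) = ∼ (nf a)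
nf (or a b) = or (nf a) (nf b)
nf (dia a) = dia (nf a)

-- [D]ψ := ¬⟨D⟩¬ψ  (with ¬ taken modulo ¬¬ψ = ψ, so ¬⟨D⟩ψ and [D]¬ψ coincide)
box : Formula → Formula
box ψ = neg (dia (∼ ψ))

subformulas : Formula → List Formula
subformulas (atom p) = atom p ∷ []
subformulas (neg a) = neg a ∷ subformulas a
subformulas (or a b) = or a b ∷ (subformulas a ++ subformulas b)
subformulas (dia a) = dia a ∷ subformulas a

CL : Formula → List Formula
CL φ = concatMap (λ χ → nf χ ∷ ∼ (nf χ) ∷ []) (subformulas φ)

record Atom (φ : Formula) : Set where
  field
    mem    : Formula → Bool
    sub    : ∀ ψ → mem ψ ≡ true → ψ ∈ CL φ
    neg-ax : ∀ ψ → ψ ∈ CL φ → (mem ψ ≡ true ⇔ (¬ (mem (∼ ψ) ≡ true)))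
    or-ax  : ∀ ψ₁ ψ₂ → or ψ₁ ψ₂ ∈ CL φ →
             (mem (or ψ₁ ψ₂) ≡ true ⇔ (mem ψ₁ ≡ true ⊎ mem ψ₂ ≡ true))
open Atom public

module _ {φ : Formula} where

  _∈A_ : Formula → Atom φ → Set
  ψ ∈A A = mem A ψ ≡ true

  Req : Atom φ → Formula → Set
  Req A ψ = dia ψ ∈A A

  Obs : Atom φ → Formula → Set
  Obs A ψ = ψ ∈A A × dia ψ ∈ CL φ

  -- A D_φ A' : for every [D]ψ ∈ A (written ¬⟨D⟩χ with ψ = ¬χ), ψ ∈ A' and [D]ψ ∈ A'
  _D[_]_ : Atom φ → Formula → Atom φ → Set
  A D[ _ ] A' = ∀ χ → neg (dia χ) ∈A A → ((∼ χ) ∈A A') × (neg (dia χ) ∈A A')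

  Step : Atom φ → Atom φ → Atom φ → Set
  Step A₁ A₂ A₃ =
    (∀ p → (atom p ∈A A₃ ⇔ (atom p ∈A A₁ × atom p ∈A A₂))) ×
    (∀ ψ → (Req A₃ ψ ⇔ (Req A₁ ψ ⊎ Req A₂ ψ ⊎ Obs A₁ ψ ⊎ Obs A₂ ψ)))

Point : ℕ → ℕ → ℕ → Set
Point N x y = x ≤ y × y ≤ N

_⊏_ : (ℕ × ℕ) → (ℕ × ℕ) → Set
_⊏_ = λ { (x' , y') (x , y) →
           x ≤ x' × y' ≤ y × ¬ ((x' , y') ≡ (x , y)) }

-- A weak compass φ-structure over {0,…,N}: a labelling L of points by φ-atoms.
-- L is given as a total function on ℕ × ℕ; only its values on points x ≤ y ≤ N matter.
module _ {φ : Formula} (N : ℕ) (L : ℕ → ℕ → Atom φ) where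

  IsCompass : Set
  IsCompass = ∀ x y x' y' → Point N x y → Point N x' y' →
              (x' , y') ⊏ (x , y) → L x y D[ φ ] L x' y'

  IsFulfilling : Set
  IsFulfilling = ∀ x y → Point N x y → ∀ ψ → Req (L x y) ψ →
                 ∃[ x' ] ∃[ y' ] (Point N x' y' × (x' , y') ⊏ (x , y) × ψ ∈A L x' y')

  IsHomogeneous : Set
  IsHomogeneous = ∀ x y → Point N x y → ∀ p →
                  (atom p ∈A L x y ⇔ (∀ x' → x ≤ x' → x' ≤ y → atom p ∈A L x' x'))

-- Every strict sub-interval of [x, z+1] lies inside [x, z] or [x+1, z+1], and A D_φ B holds
-- exactly when Req_D(B) ∪ Obs_D(B) ⊆ Req_D(A), a transitive relation.  Hence, by induction on
-- the length of intervals, homogeneity, fulfilment and the compass condition are all determined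
-- by how L(x, z+1) relates to its two maximal sub-intervals, which is what the local rule
-- L(x, z) L(x+1, z+1) ⇒ L(x, z+1) prescribes; on singletons nothing lies strictly below, so
-- fulfilment there means Req_D = ∅.
module Submission where

open import Defs
open import Data.Bool using (true)
open import Data.Bool.Properties using () renaming (_≟_ to _≟ᵇ_)
open import Data.Nat using (ℕ; zero; suc; _+_; _∸_; _≤_; _<_; s≤s; _≟_)
open import Data.Nat.Properties
  using (≤-refl; ≤-trans; ≤-antisym; ≤-pred; <⇒≤; n≤1+n; m≤n⇒m≤1+n; m≤m+n; m≤n⇒m<n∨m≡n;
         +-identityʳ; +-suc; m+[n∸m]≡n)
open import Data.List using (_∷_; [])
open import Data.List.Membership.Propositional using (_∈_; find; lose)
open import Data.List.Membership.Propositional.Properties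
  using (∈-++⁺ˡ; ∈-++⁺ʳ; ∈-++⁻; ∈-concatMap⁺; ∈-concatMap⁻)
open import Data.List.Relation.Unary.Any using (here; there)
open import Data.Product using (_×_; _,_; proj₁; proj₂; ∃-syntax)
open import Data.Product.Properties using (≡-dec)
open import Data.Product.Function.NonDependent.Propositional using (_×-⇔_)
open import Data.Sum using (_⊎_; inj₁; inj₂; [_,_]′)
open import Data.Empty using (⊥-elim)
open import Function using (_∘_)
open import Function.Bundles using (_⇔_; mk⇔; Equivalence)
open import Function.Properties.Equivalence using () renaming (sym to ⇔-sym; trans to ⇔-trans)
open import Relation.Binary.PropositionalEquality using (_≡_; refl; sym; cong; cong₂; subst)
open import Relation.Nullary using (¬_; yes; no)
open import Relation.Nullary.Decidable using (decidable-stable)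

open Equivalence

∼∼-nf : ∀ s → ∼ (∼ (nf s)) ≡ nf s
∼∼-nf (atom p) = refl
∼∼-nf (neg s)  = cong ∼_ (∼∼-nf s)
∼∼-nf (or a b) = refl
∼∼-nf (dia s)  = refl

∈-CL⁻ : ∀ {φ u} → u ∈ CL φ → ∃[ s ] (s ∈ subformulas φ × (u ≡ nf s ⊎ u ≡ ∼ (nf s)))
∈-CL⁻ u∈ with find (∈-concatMap⁻ (λ χ → nf χ ∷ ∼ (nf χ) ∷ []) u∈)
... | s , s∈ , here eq         = s , s∈ , inj₁ eq
... | s , s∈ , there (here eq) = s , s∈ , inj₂ eq

nf-∈-CL : ∀ {φ s} → s ∈ subformulas φ → nf s ∈ CL φ
nf-∈-CL s∈ = ∈-concatMap⁺ _ (lose s∈ (here refl))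

∼nf-∈-CL : ∀ {φ s} → s ∈ subformulas φ → ∼ (nf s) ∈ CL φ
∼nf-∈-CL s∈ = ∈-concatMap⁺ _ (lose s∈ (there (here refl)))

∼-∈-CL : ∀ {φ u} → u ∈ CL φ → ∼ u ∈ CL φ
∼-∈-CL {φ} u∈ with ∈-CL⁻ {φ} u∈
... | s , s∈ , inj₁ refl = ∼nf-∈-CL {φ} s∈
... | s , s∈ , inj₂ refl = subst (_∈ CL φ) (sym (∼∼-nf s)) (nf-∈-CL {φ} s∈)

subformulas-refl : ∀ s → s ∈ subformulas s
subformulas-refl (atom p) = here refl
subformulas-refl (neg s)  = here refl
subformulas-refl (or a b) = here refl
subformulas-refl (dia s)  = here refl

subformulas-trans : ∀ φ {s t} → s ∈ subformulas φ → t ∈ subformulas s → t ∈ subformulas φ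
subformulas-trans (atom p) (here refl) t∈ = t∈
subformulas-trans (neg a)  (here refl) t∈ = t∈
subformulas-trans (or a b) (here refl) t∈ = t∈
subformulas-trans (dia a)  (here refl) t∈ = t∈
subformulas-trans (neg a)  (there s∈)  t∈ = there (subformulas-trans a s∈ t∈)
subformulas-trans (dia a)  (there s∈)  t∈ = there (subformulas-trans a s∈ t∈)
subformulas-trans (or a b) (there s∈)  t∈ with ∈-++⁻ (subformulas a) s∈
... | inj₁ s∈a = there (∈-++⁺ˡ (subformulas-trans a s∈a t∈))
... | inj₂ s∈b = there (∈-++⁺ʳ (subformulas a) (subformulas-trans b s∈b t∈))

dia-nf-subformula : ∀ s {χ} → dia χ ≡ nf s ⊎ dia χ ≡ ∼ (nf s) → ∃[ t ] (t ∈ subformulas s × χ ≡ nf t)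
dia-nf-subformula (dia a) (inj₁ refl) = a , there (subformulas-refl a) , refl
dia-nf-subformula (neg a) (inj₁ eq) with dia-nf-subformula a (inj₂ eq)
... | t , t∈ , χ≡ = t , there t∈ , χ≡
dia-nf-subformula (neg a) (inj₂ eq) with dia-nf-subformula a (inj₁ (subst (_ ≡_) (∼∼-nf a) eq))
... | t , t∈ , χ≡ = t , there t∈ , χ≡
dia-nf-subformula (atom p) (inj₁ ())
dia-nf-subformula (atom p) (inj₂ ())
dia-nf-subformula (or a b) (inj₁ ())
dia-nf-subformula (or a b) (inj₂ ())
dia-nf-subformula (dia a) (inj₂ ())

dia-∈-CL⇒∈-CL : ∀ {φ χ} → dia χ ∈ CL φ → χ ∈ CL φ
dia-∈-CL⇒∈-CL {φ} dia∈ with ∈-CL⁻ dia∈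
... | s , s∈ , eq with dia-nf-subformula s eq
...   | t , t∈ , refl = nf-∈-CL (subformulas-trans φ s∈ t∈)

module _ {φ : Formula} where

  ∈A-stable : ∀ (A : Atom φ) {ψ} → ¬ ¬ ψ ∈A A → ψ ∈A A
  ∈A-stable A {ψ} = decidable-stable (mem A ψ ≟ᵇ true)

  ∈A-∼-disjoint : ∀ (A : Atom φ) {ψ} → ψ ∈A A → ¬ ((∼ ψ) ∈A A)
  ∈A-∼-disjoint A {ψ} ψ∈A = to (neg-ax A ψ (sub A ψ ψ∈A)) ψ∈A

  ∼-∈A : ∀ (A : Atom φ) {ψ} → ψ ∈ CL φ → ¬ ψ ∈A A → (∼ ψ) ∈A A
  ∼-∈A A {ψ} ψ∈CL ψ∉A = ∈A-stable A (ψ∉A ∘ from (neg-ax A ψ ψ∈CL))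

  D⇒Req⊆ : ∀ {A B : Atom φ} {ψ} → A D[ φ ] B → Req B ψ → Req A ψ
  D⇒Req⊆ {A} {B} {ψ} A-D-B r =
    ∈A-stable A λ ¬r → ∈A-∼-disjoint B r (proj₂ (A-D-B ψ (∼-∈A A (sub B (dia ψ) r) ¬r)))

  D⇒Obs⊆ : ∀ {A B : Atom φ} {ψ} → A D[ φ ] B → Obs B ψ → Req A ψ
  D⇒Obs⊆ {A} {B} {ψ} A-D-B (ψ∈B , dia∈CL) =
    ∈A-stable A λ ¬r → ∈A-∼-disjoint B ψ∈B (proj₁ (A-D-B ψ (∼-∈A A dia∈CL ¬r)))

  Req⊆⇒D : ∀ {A B : Atom φ} → (∀ {ψ} → Req B ψ → Req A ψ) → (∀ {ψ} → Obs B ψ → Req A ψ) →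
           A D[ φ ] B
  Req⊆⇒D {A} {B} req⊆ obs⊆ χ □∈A =
    ∼-∈A B (dia-∈-CL⇒∈-CL {φ} dia∈CL) (λ χ∈B → ¬req (obs⊆ (χ∈B , dia∈CL))) ,
    ∼-∈A B dia∈CL (¬req ∘ req⊆)
    where
    dia∈CL : dia χ ∈ CL φ
    dia∈CL = ∼-∈-CL {φ} (sub A (neg (dia χ)) □∈A)
    ¬req : ¬ Req A χ
    ¬req r = ∈A-∼-disjoint A r □∈A

  D-trans : ∀ {A B C : Atom φ} → A D[ φ ] B → B D[ φ ] C → A D[ φ ] C
  D-trans A-D-B B-D-C χ □∈A = B-D-C χ (proj₂ (A-D-B χ □∈A))

  Step⇒Dˡ : ∀ {A₁ A₂ A₃ : Atom φ} → Step A₁ A₂ A₃ → A₃ D[ φ ] A₁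
  Step⇒Dˡ {A₁} {A₂} {A₃} (_ , reqs) =
    Req⊆⇒D {A₃} {A₁} (λ r → from (reqs _) (inj₁ r)) (λ o → from (reqs _) (inj₂ (inj₂ (inj₁ o))))

  Step⇒Dʳ : ∀ {A₁ A₂ A₃ : Atom φ} → Step A₁ A₂ A₃ → A₃ D[ φ ] A₂
  Step⇒Dʳ {A₁} {A₂} {A₃} (_ , reqs) =
    Req⊆⇒D {A₃} {A₂} (λ r → from (reqs _) (inj₂ (inj₁ r))) (λ o → from (reqs _) (inj₂ (inj₂ (inj₂ o))))

  D²⇒Req⊇ : ∀ {A₁ A₂ A₃ : Atom φ} {ψ} → A₃ D[ φ ] A₁ → A₃ D[ φ ] A₂ →
            Req A₁ ψ ⊎ Req A₂ ψ ⊎ Obs A₁ ψ ⊎ Obs A₂ ψ → Req A₃ ψ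
  D²⇒Req⊇ {A₁} {A₂} {A₃} D₁ D₂ (inj₁ r)               = D⇒Req⊆ {A₃} {A₁} D₁ r
  D²⇒Req⊇ {A₁} {A₂} {A₃} D₁ D₂ (inj₂ (inj₁ r))        = D⇒Req⊆ {A₃} {A₂} D₂ r
  D²⇒Req⊇ {A₁} {A₂} {A₃} D₁ D₂ (inj₂ (inj₂ (inj₁ o))) = D⇒Obs⊆ {A₃} {A₁} D₁ o
  D²⇒Req⊇ {A₁} {A₂} {A₃} D₁ D₂ (inj₂ (inj₂ (inj₂ o))) = D⇒Obs⊆ {A₃} {A₂} D₂ o

_⊑_ : ℕ × ℕ → ℕ × ℕ → Set
(x' , y') ⊑ (x , y) = x ≤ x' × y' ≤ y

⊑⇒≡⊎⊏ : ∀ {x y x' y'} → (x' , y') ⊑ (x , y) → (x' , y') ≡ (x , y) ⊎ (x' , y') ⊏ (x , y)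
⊑⇒≡⊎⊏ {x} {y} {x'} {y'} (x≤x' , y'≤y) with ≡-dec _≟_ _≟_ (x' , y') (x , y)
... | yes eq = inj₁ eq
... | no ≢  = inj₂ (x≤x' , y'≤y , ≢)

⊏-trans : ∀ {x y x' y' x'' y''} → (x'' , y'') ⊏ (x' , y') → (x' , y') ⊏ (x , y) → (x'' , y'') ⊏ (x , y)
⊏-trans (x'≤x'' , y''≤y' , ≢₁) (x≤x' , y'≤y , _) =
  ≤-trans x≤x' x'≤x'' , ≤-trans y''≤y' y'≤y ,
  λ { refl → ≢₁ (cong₂ _,_ (≤-antisym x≤x' x'≤x'') (≤-antisym y''≤y' y'≤y)) }

⊏-shrinkʳ : ∀ {x z} → (x , z) ⊏ (x , suc z)
⊏-shrinkʳ {x} {z} = ≤-refl , n≤1+n z , λ ()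

⊏-shrinkˡ : ∀ {x z} → (suc x , z) ⊏ (x , z)
⊏-shrinkˡ {x} = n≤1+n x , ≤-refl , λ ()

⊏-cover : ∀ {x z x' y'} → (x' , y') ⊏ (x , suc z) → (x' , y') ⊑ (x , z) ⊎ (x' , y') ⊑ (suc x , suc z)
⊏-cover (x≤x' , y'≤1+z , ≢) with m≤n⇒m<n∨m≡n x≤x' | m≤n⇒m<n∨m≡n y'≤1+z
... | inj₁ x<x' | _           = inj₂ (x<x' , y'≤1+z)
... | inj₂ refl | inj₁ y'<1+z = inj₁ (≤-refl , ≤-pred y'<1+z)
... | inj₂ refl | inj₂ refl   = ⊥-elim (≢ refl)

⊏-diagonal-minimal : ∀ {x x' y'} → x' ≤ y' → ¬ ((x' , y') ⊏ (x , x))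
⊏-diagonal-minimal x'≤y' (x≤x' , y'≤x , ≢) =
  ≢ (cong₂ _,_ (≤-antisym (≤-trans x'≤y' y'≤x) x≤x') (≤-antisym y'≤x (≤-trans x≤x' x'≤y')))

module _ (P : ℕ → ℕ → Set)
         (P-diagonal : ∀ x → P x x)
         (P-extend : ∀ {x z} → x ≤ z → P x z → P (suc x) (suc z) → P x (suc z)) where

  interval-ind : ∀ {x y} → x ≤ y → P x y
  interval-ind {x} x≤y = subst (P x) (m+[n∸m]≡n x≤y) (ind _ x)
    where
    ind : ∀ d x → P x (x + d)
    ind zero    x = subst (P x) (sym (+-identityʳ x)) (P-diagonal x)
    ind (suc d) x = subst (P x) (sym (+-suc x d)) (P-extend (m≤m+n x d) (ind d x) (ind d (suc x)))

AllBetween : (ℕ → Set) → ℕ → ℕ → Set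
AllBetween P x y = ∀ i → x ≤ i → i ≤ y → P i

AllBetween-diagonal : ∀ {P x} → AllBetween P x x ⇔ P x
AllBetween-diagonal {P} {x} =
  mk⇔ (λ all → all x ≤-refl ≤-refl) (λ { Px i x≤i i≤x → subst P (≤-antisym x≤i i≤x) Px })

AllBetween-split : ∀ {P x z} → x ≤ z →
                   AllBetween P x (suc z) ⇔ (AllBetween P x z × AllBetween P (suc x) (suc z))
AllBetween-split {P} {x} {z} x≤z = mk⇔ split join
  where
  split : AllBetween P x (suc z) → AllBetween P x z × AllBetween P (suc x) (suc z)
  split all = (λ i x≤i i≤z → all i x≤i (m≤n⇒m≤1+n i≤z)) ,
              (λ i x<i → all i (≤-trans (n≤1+n x) x<i))
  join : AllBetween P x z × AllBetween P (suc x) (suc z) → AllBetween P x (suc z)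
  join (allˡ , allʳ) i x≤i i≤1+z with m≤n⇒m<n∨m≡n x≤i
  ... | inj₁ x<i = allʳ i x<i i≤1+z
  ... | inj₂ refl = allˡ x ≤-refl x≤z

module _ {φ : Formula} {N : ℕ} {L : ℕ → ℕ → Atom φ} where

  LocallyConsistent : Set
  LocallyConsistent = ∀ x y → Point N x y →
    (x < y → Step (L x (y ∸ 1)) (L (suc x) y) (L x y)) × (x ≡ y → ∀ ψ → ¬ Req (L x y) ψ)

  WitnessBelow : ℕ → ℕ → Formula → Set
  WitnessBelow x y ψ = ∃[ x' ] ∃[ y' ] (Point N x' y' × (x' , y') ⊏ (x , y) × ψ ∈A L x' y')

  WitnessBelow-⊏ : ∀ {x y x' y' ψ} → (x' , y') ⊏ (x , y) → WitnessBelow x' y' ψ → WitnessBelow x y ψ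
  WitnessBelow-⊏ sq (x'' , y'' , pt , sq' , ψ∈) = x'' , y'' , pt , ⊏-trans sq' sq , ψ∈

  HomogeneousAt : ℕ → ℕ → Set
  HomogeneousAt x y = ∀ p → atom p ∈A L x y ⇔ AllBetween (λ i → atom p ∈A L i i) x y

  module FromLocal (local : LocallyConsistent) where

    step : ∀ {x z} → x ≤ z → suc z ≤ N → Step (L x z) (L (suc x) (suc z)) (L x (suc z))
    step x≤z 1+z≤N = proj₁ (local _ _ (m≤n⇒m≤1+n x≤z , 1+z≤N)) (s≤s x≤z)

    homogeneous : IsHomogeneous N L
    homogeneous _ _ (x≤y , y≤N) = interval-ind (λ x y → y ≤ N → HomogeneousAt x y)
      (λ _ _ _ → ⇔-sym AllBetween-diagonal) extend x≤y y≤N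
      where
      extend : ∀ {x z} → x ≤ z →
               (z ≤ N → HomogeneousAt x z) → (suc z ≤ N → HomogeneousAt (suc x) (suc z)) → suc z ≤ N → HomogeneousAt x (suc z)
      extend x≤z homˡ homʳ 1+z≤N p =
        ⇔-trans (proj₁ (step x≤z 1+z≤N) p)
                (⇔-trans (homˡ (<⇒≤ 1+z≤N) p ×-⇔ homʳ 1+z≤N p) (⇔-sym (AllBetween-split x≤z)))

    fulfilling : IsFulfilling N L
    fulfilling _ _ (x≤y , y≤N) =
      interval-ind (λ x y → y ≤ N → ∀ ψ → Req (L x y) ψ → WitnessBelow x y ψ)
      (λ x x≤N ψ r → ⊥-elim (proj₂ (local x x (≤-refl , x≤N)) refl ψ r)) extend x≤y y≤N
      where
      extend : ∀ {x z} → x ≤ z →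
               (z ≤ N → ∀ ψ → Req (L x z) ψ → WitnessBelow x z ψ) →
               (suc z ≤ N → ∀ ψ → Req (L (suc x) (suc z)) ψ → WitnessBelow (suc x) (suc z) ψ) →
               suc z ≤ N → ∀ ψ → Req (L x (suc z)) ψ → WitnessBelow x (suc z) ψ
      extend x≤z fulˡ fulʳ 1+z≤N ψ r with to (proj₂ (step x≤z 1+z≤N) ψ) r
      ... | inj₁ rˡ                     = WitnessBelow-⊏ ⊏-shrinkʳ (fulˡ (<⇒≤ 1+z≤N) ψ rˡ)
      ... | inj₂ (inj₁ rʳ)              = WitnessBelow-⊏ ⊏-shrinkˡ (fulʳ 1+z≤N ψ rʳ)
      ... | inj₂ (inj₂ (inj₁ (ψ∈ , _))) = _ , _ , (x≤z , <⇒≤ 1+z≤N) , ⊏-shrinkʳ , ψ∈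
      ... | inj₂ (inj₂ (inj₂ (ψ∈ , _))) = _ , _ , (s≤s x≤z , 1+z≤N) , ⊏-shrinkˡ , ψ∈

    D-shrinkʳ : ∀ {x z} → x ≤ z → suc z ≤ N → L x (suc z) D[ φ ] L x z
    D-shrinkʳ {x} {z} x≤z 1+z≤N =
      Step⇒Dˡ {A₁ = L x z} {A₂ = L (suc x) (suc z)} {A₃ = L x (suc z)} (step x≤z 1+z≤N)

    D-shrinkˡ : ∀ {x z} → x ≤ z → suc z ≤ N → L x (suc z) D[ φ ] L (suc x) (suc z)
    D-shrinkˡ {x} {z} x≤z 1+z≤N =
      Step⇒Dʳ {A₁ = L x z} {A₂ = L (suc x) (suc z)} {A₃ = L x (suc z)} (step x≤z 1+z≤N)

    CompassAt : ℕ → ℕ → Set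
    CompassAt x y = ∀ {x' y'} → x' ≤ y' → (x' , y') ⊏ (x , y) → L x y D[ φ ] L x' y'

    D-descend : ∀ {A : Atom φ} {a b x' y'} → A D[ φ ] L a b → CompassAt a b →
                x' ≤ y' → (x' , y') ⊑ (a , b) → A D[ φ ] L x' y'
    D-descend {A} {a} {b} {x'} {y'} A-D-Lab compass x'≤y' sq with ⊑⇒≡⊎⊏ sq
    ... | inj₁ refl = A-D-Lab
    ... | inj₂ sq'  = D-trans {A = A} {B = L a b} {C = L x' y'} A-D-Lab (compass x'≤y' sq')

    compass : IsCompass N L
    compass _ _ _ _ (x≤y , y≤N) (x'≤y' , _) = interval-ind (λ x y → y ≤ N → CompassAt x y)
      (λ _ _ x'≤y' sq → ⊥-elim (⊏-diagonal-minimal x'≤y' sq)) extend x≤y y≤N x'≤y'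
      where
      extend : ∀ {x z} → x ≤ z →
               (z ≤ N → CompassAt x z) → (suc z ≤ N → CompassAt (suc x) (suc z)) → suc z ≤ N → CompassAt x (suc z)
      extend {x} {z} x≤z compassˡ compassʳ 1+z≤N x'≤y' sq with ⊏-cover sq
      ... | inj₁ sqˡ =
        D-descend {L x (suc z)} {x} {z} (D-shrinkʳ x≤z 1+z≤N) (compassˡ (<⇒≤ 1+z≤N)) x'≤y' sqˡ
      ... | inj₂ sqʳ =
        D-descend {L x (suc z)} {suc x} {suc z} (D-shrinkˡ x≤z 1+z≤N) (compassʳ 1+z≤N) x'≤y' sqʳ

  module ToLocal (homogeneous : IsHomogeneous N L) (fulfilling : IsFulfilling N L)
                 (compass : IsCompass N L) where

    Req-diagonal-empty : ∀ {x} → x ≤ N → ∀ ψ → ¬ Req (L x x) ψ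
    Req-diagonal-empty x≤N ψ r with fulfilling _ _ (≤-refl , x≤N) ψ r
    ... | _ , _ , (x'≤y' , _) , sq , _ = ⊏-diagonal-minimal x'≤y' sq

    ReqObs-below : ∀ {a b x' y' ψ} → Point N a b → Point N x' y' → (x' , y') ⊑ (a , b) →
                   ψ ∈A L x' y' → dia ψ ∈ CL φ → Req (L a b) ψ ⊎ Obs (L a b) ψ
    ReqObs-below {a} {b} {x'} {y'} pt pt' sq ψ∈ dia∈CL with ⊑⇒≡⊎⊏ sq
    ... | inj₁ refl = inj₂ (ψ∈ , dia∈CL)
    ... | inj₂ sq'  =
      inj₁ (D⇒Obs⊆ {A = L a b} {B = L x' y'} (compass _ _ _ _ pt pt' sq') (ψ∈ , dia∈CL))

    step : ∀ {x z} → x ≤ z → suc z ≤ N → Step (L x z) (L (suc x) (suc z)) (L x (suc z))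
    step {x} {z} x≤z 1+z≤N = atoms , λ ψ → mk⇔ Req⊆ Req⊇
      where
      pt : Point N x (suc z)
      pt = m≤n⇒m≤1+n x≤z , 1+z≤N
      ptˡ : Point N x z
      ptˡ = x≤z , <⇒≤ 1+z≤N
      ptʳ : Point N (suc x) (suc z)
      ptʳ = s≤s x≤z , 1+z≤N
      atoms : ∀ p → atom p ∈A L x (suc z) ⇔ (atom p ∈A L x z × atom p ∈A L (suc x) (suc z))
      atoms p = ⇔-trans (homogeneous _ _ pt p)
                  (⇔-trans (AllBetween-split x≤z)
                           (⇔-sym (homogeneous _ _ ptˡ p ×-⇔ homogeneous _ _ ptʳ p)))
      Req⊆ : ∀ {ψ} → Req (L x (suc z)) ψ →
             Req (L x z) ψ ⊎ Req (L (suc x) (suc z)) ψ ⊎ Obs (L x z) ψ ⊎ Obs (L (suc x) (suc z)) ψ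
      Req⊆ {ψ} r with fulfilling _ _ pt ψ r
      ... | _ , _ , pt' , sq , ψ∈ with ⊏-cover sq
      ...   | inj₁ sqˡ = [ inj₁ , inj₂ ∘ inj₂ ∘ inj₁ ]′
                           (ReqObs-below ptˡ pt' sqˡ ψ∈ (sub (L x (suc z)) (dia ψ) r))
      ...   | inj₂ sqʳ = [ inj₂ ∘ inj₁ , inj₂ ∘ inj₂ ∘ inj₂ ]′
                           (ReqObs-below ptʳ pt' sqʳ ψ∈ (sub (L x (suc z)) (dia ψ) r))
      Req⊇ : ∀ {ψ} → Req (L x z) ψ ⊎ Req (L (suc x) (suc z)) ψ ⊎ Obs (L x z) ψ ⊎ Obs (L (suc x) (suc z)) ψ →
             Req (L x (suc z)) ψ
      Req⊇ = D²⇒Req⊇ {A₁ = L x z} {A₂ = L (suc x) (suc z)} {A₃ = L x (suc z)}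
                     (compass _ _ _ _ pt ptˡ ⊏-shrinkʳ) (compass _ _ _ _ pt ptʳ ⊏-shrinkˡ)

    local : LocallyConsistent
    local x zero    (_ , 0≤N)   = (λ ()) , λ { refl → Req-diagonal-empty 0≤N }
    local x (suc z) (_ , 1+z≤N) = (λ { (s≤s x≤z) → step x≤z 1+z≤N }) ,
                                  λ { refl → Req-diagonal-empty 1+z≤N }

lemma3p3 : (φ : Formula) (N : ℕ) (L : ℕ → ℕ → Atom φ) →
           ((IsHomogeneous N L × IsFulfilling N L × IsCompass N L) ⇔
            (∀ x y → Point N x y →
               (x < y → Step (L x (y ∸ 1)) (L (suc x) y) (L x y)) ×
               (x ≡ y → ∀ ψ → ¬ Req (L x y) ψ)))
lemma3p3 φ N L = mk⇔ (λ (hom , ful , com) → ToLocal.local {N = N} {L} hom ful com)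
                     (λ local → let open FromLocal {N = N} {L} local
                                in homogeneous , fulfilling , compass)
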